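{- Let $n$ be a positive integer. Then $\dim\Omega_n^{t\&h}=\frac{n^2}{4}$ if $n$ is even, and $\dim\Omega_n^{t\&h}=\frac{n^2-1}{4}$ if $n$ is odd.
   Context: For an $n\times n$ matrix $A=[a_{ij}]$: $A^t$ is its transpose; its Hankel transpose $A^h$ has $(i,j)$ entry $a_{n+1-j,n+1-i}$; $A$ is Hankel-symmetric if $A^h=A$. A doubly stochastic matrix has nonnegative entries and all row and column sums equal to $1$. $\Omega_n^{t\&h}$ denotes the convex polytope of all $n\times n$ doubly stochastic matrices $A$ with $A^t=A$ and $A^h=A$; its dimension is the dimension of its affine hull.
   Formalization: The matrices in $\Omega_n^{t\&h}$ have rational entries, and affine independence, hence the dimension, is taken with rational coefficients. -}

module Defs where

open import Data.Nat using (ℕ; zero; suc)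
open import Data.Fin using (Fin; zero; suc; opposite)
open import Data.Rational using (ℚ; 0ℚ; 1ℚ; _+_; _*_; _≤_)
open import Data.Product using (Σ; _×_; _,_)
open import Relation.Binary.PropositionalEquality using (_≡_)
open import Relation.Nullary using (¬_)

Σ[_] : ∀ {k} → (Fin k → ℚ) → ℚ
Σ[_] {zero}  f = 0ℚ
Σ[_] {suc k} f = f zero + Σ[ (λ i → f (suc i)) ]

Mat : ℕ → Set
Mat n = Fin n → Fin n → ℚ

transpose : ∀ {n} → Mat n → Mat n
transpose A i j = A j i

-- Hankel transpose: (A^h)_{ij} = a_{n+1-j, n+1-i}; with 0-based indices,
-- n+1-j corresponds to 'opposite j' (= n-1-j).
hankelTranspose : ∀ {n} → Mat n → Mat n
hankelTranspose A i j = A (opposite j) (opposite i)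

DoublyStochastic : ∀ {n} → Mat n → Set
DoublyStochastic {n} A =
  (∀ i j → 0ℚ ≤ A i j) ×
  (∀ i → Σ[ (λ j → A i j) ] ≡ 1ℚ) ×
  (∀ j → Σ[ (λ i → A i j) ] ≡ 1ℚ)

InΩth : ∀ {n} → Mat n → Set
InΩth A = DoublyStochastic A × (∀ i j → transpose A i j ≡ A i j)
                             × (∀ i j → hankelTranspose A i j ≡ A i j)

AffinelyIndependent : ∀ {n k} → (Fin k → Mat n) → Set
AffinelyIndependent {n} {k} P =
  ∀ (c : Fin k → ℚ) → Σ[ c ] ≡ 0ℚ →
    (∀ i j → Σ[ (λ l → c l * P l i j) ] ≡ 0ℚ) → ∀ l → c l ≡ 0ℚ

HasAffineDim : ∀ {n} → (Mat n → Set) → ℕ → Set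
HasAffineDim {n} S d =
  Σ (Fin (suc d) → Mat n) (λ P → (∀ l → S (P l)) × AffinelyIndependent P) ×
  (∀ (P : Fin (suc (suc d)) → Mat n) → (∀ l → S (P l)) → ¬ AffinelyIndependent P)

module Submission where

-- The transpose and the Hankel transpose generate a Klein four-group acting on the cells of an
-- n × n matrix.  A difference of points of Ω_n^{t&h} is symmetric, Hankel-symmetric and has zero
-- row sums ("balanced"), and a balanced matrix is determined by its entries at one representative
-- of each orbit off the antidiagonal: the antidiagonal entries are then forced by the row sums.
-- Writing n = 2m + b with b ≤ 1, the representatives {(i, j) : i ≤ j, i + j < n - 1} are
-- m(m + b) = ⌊n²/4⌋ in number, so m(m + b) + 2 points of Ω always satisfy a nontrivial affine
-- relation (an underdetermined homogeneous linear system).  Conversely, for each representative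
-- x the matrix "twice the orbit sum of x, minus the orbit sums of the antidiagonal cells in the
-- rows of x" is balanced, nonzero at x and zero at every other representative, so small
-- multiples of these added to the uniform matrix give m(m + b) + 1 affinely independent points.

module Sums where
  open import Algebra.Bundles using (Ring)
  open import Data.Fin using (Fin; zero; suc; punchIn)
  open import Data.Fin.Properties using (punchInᵢ≢i)
  open import Data.Nat using (zero; suc)
  open import Data.Rational using (ℚ; 0ℚ; 1ℚ; _+_; _*_; _-_; -_)
  open import Data.Rational.Properties using (+-*-ring; +-identityʳ)
  open import Defs using (Σ[_])
  open import Function using (_∘_)
  open import Relation.Binary.PropositionalEquality

  open import Algebra.Properties.Ring +-*-ring using (-1*x≈-x)
  open import Algebra.Properties.Semiring.Sum (Ring.semiring +-*-ring) public
    using (sum; sum-cong-≗; sum-remove; sum-replicate; sum-replicate-zero; ∑-distrib-+; ∑-comm;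
           *-distribˡ-sum; *-distribʳ-sum)
  open ≡-Reasoning

  Σ≡sum : ∀ {k} (f : Fin k → ℚ) → Σ[ f ] ≡ sum f
  Σ≡sum {zero}  f = refl
  Σ≡sum {suc k} f = cong (f zero +_) (Σ≡sum (f ∘ suc))

  sum-single : ∀ {k} (f : Fin k → ℚ) (v : Fin k) → (∀ u → u ≢ v → f u ≡ 0ℚ) → sum f ≡ f v
  sum-single {suc k} f v f-off = begin
    sum f                       ≡⟨ sum-remove {i = v} f ⟩
    f v + sum (f ∘ punchIn v)   ≡⟨ cong (f v +_) (sum-cong-≗ {k} (λ u → f-off _ (punchInᵢ≢i v u))) ⟩
    f v + sum {k} (λ _ → 0ℚ)    ≡⟨ cong (f v +_) (sum-replicate-zero k) ⟩
    f v + 0ℚ                    ≡⟨ +-identityʳ (f v) ⟩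
    f v                         ∎

  ∑-distrib-- : ∀ {k} (f g : Fin k → ℚ) → sum (λ j → f j - g j) ≡ sum f - sum g
  ∑-distrib-- {k} f g = begin
    sum (λ j → f j - g j)           ≡⟨ ∑-distrib-+ f (λ j → - g j) ⟩
    sum f + sum (λ j → - g j)       ≡⟨ cong (sum f +_) (sum-cong-≗ {k} (λ j → sym (-1*x≈-x (g j)))) ⟩
    sum f + sum (λ j → - 1ℚ * g j)  ≡⟨ cong (sum f +_) (sym (*-distribˡ-sum (- 1ℚ) g)) ⟩
    sum f + - 1ℚ * sum g            ≡⟨ cong (sum f +_) (-1*x≈-x (sum g)) ⟩
    sum f - sum g                   ∎

module LinearAlgebra where
  open import Data.Fin using (Fin; zero; suc; punchIn)
  open import Data.Fin.Properties using (all?; ¬∀⟶∃¬)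
  open import Data.Nat using (zero; suc; _<_; s≤s)
  open import Data.Nat.Properties using (m<n⇒m<1+n)
  open import Data.Product using (_,_)
  open import Data.Rational using (ℚ; 0ℚ; 1ℚ; _+_; _*_; _-_; -_; _÷_; 1/_; NonZero)
  open import Data.Rational.Base using (≢-nonZero)
  open import Data.Rational.Properties using (_≟_; *-zeroˡ; *-inverseʳ)
  open import Data.Rational.Solver using (module +-*-Solver)
  open import Data.Vec.Functional using (insertAt)
  open import Data.Vec.Functional.Properties using (insertAt-lookup; insertAt-punchIn)
  open import Function using (_∘_)
  open import Relation.Binary.PropositionalEquality
  open import Relation.Nullary using (yes; no)
  open Sums
  open +-*-Solver using (solve; _:+_; _:*_; _:-_; :-_; _:=_; con)
  open ≡-Reasoning

  record NonzeroSolution {k m} (A : Fin k → Fin m → ℚ) : Set where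
    field
      solution : Fin m → ℚ
      solves   : ∀ e → sum (λ l → A e l * solution l) ≡ 0ℚ
      support  : Fin m
      nonzero  : solution support ≢ 0ℚ

  sum-insertAt : ∀ {m} (B : Fin (suc m) → ℚ) (x : Fin m → ℚ) l₀ v →
    sum (λ l → B l * insertAt x l₀ v l) ≡ B l₀ * v + sum (λ l → B (punchIn l₀ l) * x l)
  sum-insertAt {m} B x l₀ v = trans (sum-remove {i = l₀} (λ l → B l * insertAt x l₀ v l))
    (cong₂ _+_ (cong (B l₀ *_) (insertAt-lookup x l₀ v))
               (sum-cong-≗ {m} (λ l → cong (B (punchIn l₀ l) *_) (insertAt-punchIn x l₀ v l))))

  prependZeroRow : ∀ {k m} (A : Fin (suc k) → Fin m → ℚ) → (∀ l → A zero l ≡ 0ℚ) →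
                   NonzeroSolution (A ∘ suc) → NonzeroSolution A
  prependZeroRow {m = m} A row₀≡0 s = record
    { solution = solution ; solves = solves′ ; support = support ; nonzero = nonzero }
    where
    open NonzeroSolution s
    solves′ : ∀ e → sum (λ l → A e l * solution l) ≡ 0ℚ
    solves′ zero    = trans (sum-cong-≗ {m} (λ l → trans (cong (_* solution l) (row₀≡0 l)) (*-zeroˡ (solution l))))
                            (sum-replicate-zero m)
    solves′ (suc e) = solves e

  -- The equations left after eliminating the unknown l₀ by means of equation zero.
  eliminated : ∀ {k m} (A : Fin (suc k) → Fin (suc m) → ℚ) l₀ → .{{NonZero (A zero l₀)}} →
               Fin k → Fin m → ℚ
  eliminated A l₀ e l = A (suc e) (punchIn l₀ l) - (A (suc e) l₀ ÷ A zero l₀) * A zero (punchIn l₀ l)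

  eliminatePivot : ∀ {k m} (A : Fin (suc k) → Fin (suc m) → ℚ) l₀ → .{{_ : NonZero (A zero l₀)}} →
                   NonzeroSolution (eliminated A l₀) → NonzeroSolution A
  eliminatePivot {m = m} A l₀ s = record
    { solution = insertAt solution l₀ v
    ; solves   = solves′
    ; support  = punchIn l₀ support
    ; nonzero  = λ eq → nonzero (trans (sym (insertAt-punchIn solution l₀ v support)) eq)
    }
    where
    open NonzeroSolution s
    p = A zero l₀
    S = sum (λ l → A zero (punchIn l₀ l) * solution l)
    v = - (S ÷ p)

    solves′ : ∀ e → sum (λ l → A e l * insertAt solution l₀ v l) ≡ 0ℚ
    solves′ zero = begin
      sum (λ l → A zero l * insertAt solution l₀ v l) ≡⟨ sum-insertAt (A zero) solution l₀ v ⟩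
      p * v + S
        ≡⟨ solve 3 (λ p S t → p :* (:- (S :* t)) :+ S := S :- S :* (p :* t)) refl p S (1/ p) ⟩
      S - S * (p * 1/ p)  ≡⟨ cong (λ t → S - S * t) (*-inverseʳ p) ⟩
      S - S * 1ℚ          ≡⟨ solve 1 (λ S → S :- S :* con 1ℚ := con 0ℚ) refl S ⟩
      0ℚ                  ∎
    solves′ (suc e) = begin
      sum (λ l → B l * insertAt solution l₀ v l)             ≡⟨ sum-insertAt B solution l₀ v ⟩
      B l₀ * v + sum (λ l → B (punchIn l₀ l) * solution l)   ≡⟨ cong (B l₀ * v +_) reducedRow ⟩
      B l₀ * v + (0ℚ + f * S)
        ≡⟨ solve 3 (λ b S t → b :* (:- (S :* t)) :+ (con 0ℚ :+ b :* t :* S) := con 0ℚ) refl (B l₀) S (1/ p) ⟩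
      0ℚ ∎
      where
      B = A (suc e)
      f = B l₀ ÷ p
      reducedRow : sum (λ l → B (punchIn l₀ l) * solution l) ≡ 0ℚ + f * S
      reducedRow = begin
        sum (λ l → B (punchIn l₀ l) * solution l)
          ≡⟨ sum-cong-≗ {m} (λ l → solve 4 (λ b x f a → b :* x := (b :- f :* a) :* x :+ f :* (a :* x)) refl
                                            (B (punchIn l₀ l)) (solution l) f (A zero (punchIn l₀ l))) ⟩
        sum (λ l → eliminated A l₀ e l * solution l + f * (A zero (punchIn l₀ l) * solution l))
          ≡⟨ ∑-distrib-+ (λ l → eliminated A l₀ e l * solution l) (λ l → f * (A zero (punchIn l₀ l) * solution l))
          ⟩
        sum (λ l → eliminated A l₀ e l * solution l) + sum (λ l → f * (A zero (punchIn l₀ l) * solution l))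
          ≡⟨ cong₂ _+_ (solves e) (sym (*-distribˡ-sum f (λ l → A zero (punchIn l₀ l) * solution l))) ⟩
        0ℚ + f * S ∎

  underdetermined⇒nonzeroSolution : ∀ {k m} → k < m → (A : Fin k → Fin m → ℚ) → NonzeroSolution A
  underdetermined⇒nonzeroSolution {zero} {suc m} _ A =
    record { solution = λ _ → 1ℚ ; solves = λ () ; support = zero ; nonzero = λ () }
  underdetermined⇒nonzeroSolution {suc k} {suc m} (s≤s k<m) A with all? (λ l → A zero l ≟ 0ℚ)
  ... | yes row₀≡0 = prependZeroRow A row₀≡0 (underdetermined⇒nonzeroSolution (m<n⇒m<1+n k<m) (A ∘ suc))
  ... | no  row₀≢0 with ¬∀⟶∃¬ _ _ (λ l → A zero l ≟ 0ℚ) row₀≢0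
  ...   | l₀ , pivot≢0 = eliminatePivot A l₀ {{≢-nonZero pivot≢0}}
                           (underdetermined⇒nonzeroSolution k<m (eliminated A l₀ {{≢-nonZero pivot≢0}}))

module AffineDimension where
  open import Data.Fin using (Fin; zero; suc)
  open import Data.Nat using (suc)
  open import Data.Nat.Properties using (≤-refl)
  open import Data.Product using (_×_; proj₁; proj₂)
  open import Data.Rational using (ℚ; 0ℚ; 1ℚ; _+_; _*_; 1/_)
  open import Data.Rational.Base using (≢-nonZero)
  open import Data.Rational.Properties
    using (+-identityʳ; +-identityˡ; +-assoc; *-zeroˡ; *-zeroʳ; *-identityˡ; *-identityʳ; *-assoc; *-comm;
           *-distribˡ-+; *-inverseʳ)
  open import Defs using (Σ[_]; Mat; AffinelyIndependent)
  open import Function using (_∘_)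
  open import Relation.Binary.PropositionalEquality
  open import Relation.Nullary using (¬_)
  open Sums
  open LinearAlgebra
  open ≡-Reasoning

  p*q≡0⇒p≡0 : ∀ p q → q ≢ 0ℚ → p * q ≡ 0ℚ → p ≡ 0ℚ
  p*q≡0⇒p≡0 p q q≢0 pq≡0 = begin
    p                  ≡⟨ sym (*-identityʳ p) ⟩
    p * 1ℚ             ≡⟨ cong (p *_) (sym (*-inverseʳ q)) ⟩
    p * (q * 1/ q)     ≡⟨ sym (*-assoc p q (1/ q)) ⟩
    p * q * 1/ q       ≡⟨ cong (_* 1/ q) pq≡0 ⟩
    0ℚ * 1/ q          ≡⟨ *-zeroˡ (1/ q) ⟩
    0ℚ                 ∎
    where instance _ = ≢-nonZero q≢0

  _at_ : ∀ {n} → Mat n → Fin n × Fin n → ℚ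
  A at x = A (proj₁ x) (proj₂ x)

  combination : ∀ {n k} → (Fin k → ℚ) → (Fin k → Mat n) → Mat n
  combination c P i j = sum (λ l → c l * P l i j)

  -- Differences of points of S are the combinations of total weight 0.
  CellsDetermineDifferences : ∀ {n d} → (Mat n → Set) → (Fin d → Fin n × Fin n) → Set
  CellsDetermineDifferences {n} S cell =
    ∀ {k} (c : Fin k → ℚ) (P : Fin k → Mat n) → (∀ l → S (P l)) → sum c ≡ 0ℚ →
    (∀ u → combination c P at cell u ≡ 0ℚ) → ∀ i j → combination c P i j ≡ 0ℚ

  ¬affinelyIndependent : ∀ {n d} (S : Mat n → Set) (cell : Fin d → Fin n × Fin n) →
    CellsDetermineDifferences S cell →
    (P : Fin (suc (suc d)) → Mat n) → (∀ l → S (P l)) → ¬ AffinelyIndependent P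
  ¬affinelyIndependent {n} {d} S cell determine P P∈S independent =
    nonzero (independent solution Σc≡0 combination≡0 support)
    where
    equations : Fin (suc d) → Fin (suc (suc d)) → ℚ
    equations zero    l = 1ℚ
    equations (suc u) l = P l at cell u
    open NonzeroSolution (underdetermined⇒nonzeroSolution ≤-refl equations)
    sum-c≡0 : sum solution ≡ 0ℚ
    sum-c≡0 = trans (sum-cong-≗ (λ l → sym (*-identityˡ (solution l)))) (solves zero)
    Σc≡0 : Σ[ solution ] ≡ 0ℚ
    Σc≡0 = trans (Σ≡sum solution) sum-c≡0
    combination≡0 : ∀ i j → Σ[ (λ l → solution l * P l i j) ] ≡ 0ℚ
    combination≡0 i j = trans (Σ≡sum (λ l → solution l * P l i j)) (determine solution P P∈S sum-c≡0
      (λ u → trans (sum-cong-≗ (λ l → *-comm (solution l) (P l at cell u))) (solves (suc u))) i j)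

  baseAndTranslates : ∀ {n d} → Mat n → (Fin d → Mat n) → Fin (suc d) → Mat n
  baseAndTranslates P₀ E zero    = P₀
  baseAndTranslates P₀ E (suc u) = λ i j → P₀ i j + E u i j

  combination-baseAndTranslates : ∀ {n d} (c : Fin (suc d) → ℚ) (P₀ : Mat n) (E : Fin d → Mat n) i j →
    combination c (baseAndTranslates P₀ E) i j ≡ sum c * P₀ i j + combination (c ∘ suc) E i j
  combination-baseAndTranslates {d = d} c P₀ E i j = begin
    c zero * P₀ i j + sum (λ u → c (suc u) * (P₀ i j + E u i j))
      ≡⟨ cong (c zero * P₀ i j +_) (trans (sum-cong-≗ {d} (λ u → *-distribˡ-+ (c (suc u)) (P₀ i j) (E u i j)))
                                          (∑-distrib-+ (λ u → c (suc u) * P₀ i j) (λ u → c (suc u) * E u i j))) ⟩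
    c zero * P₀ i j + (sum (λ u → c (suc u) * P₀ i j) + combination (c ∘ suc) E i j)
      ≡⟨ sym (+-assoc (c zero * P₀ i j) _ _) ⟩
    sum (λ l → c l * P₀ i j) + combination (c ∘ suc) E i j
      ≡⟨ cong (_+ combination (c ∘ suc) E i j) (sym (*-distribʳ-sum (P₀ i j) c)) ⟩
    sum c * P₀ i j + combination (c ∘ suc) E i j ∎

  affinelyIndependent-baseAndTranslates : ∀ {n d} (cell : Fin d → Fin n × Fin n) (P₀ : Mat n) (E : Fin d → Mat n) →
    (∀ u v → u ≢ v → E u at cell v ≡ 0ℚ) → (∀ u → E u at cell u ≢ 0ℚ) →
    AffinelyIndependent (baseAndTranslates P₀ E)
  affinelyIndependent-baseAndTranslates {d = d} cell P₀ E E-off E-diag c Σc≡0 combination≡0 = c≡0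
    where
    sum-c≡0 : sum c ≡ 0ℚ
    sum-c≡0 = trans (sym (Σ≡sum c)) Σc≡0
    translates≡0 : ∀ i j → combination (c ∘ suc) E i j ≡ 0ℚ
    translates≡0 i j = begin
      combination (c ∘ suc) E i j
        ≡⟨ sym (+-identityˡ _) ⟩
      0ℚ + combination (c ∘ suc) E i j
        ≡⟨ cong (_+ combination (c ∘ suc) E i j) (sym (trans (cong (_* P₀ i j) sum-c≡0) (*-zeroˡ (P₀ i j)))) ⟩
      sum c * P₀ i j + combination (c ∘ suc) E i j
        ≡⟨ sym (combination-baseAndTranslates c P₀ E i j) ⟩
      combination c (baseAndTranslates P₀ E) i j
        ≡⟨ sym (Σ≡sum (λ l → c l * baseAndTranslates P₀ E l i j)) ⟩
      Σ[ (λ l → c l * baseAndTranslates P₀ E l i j) ]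
        ≡⟨ combination≡0 i j ⟩
      0ℚ ∎
    c-suc≡0 : ∀ v → c (suc v) ≡ 0ℚ
    c-suc≡0 v = p*q≡0⇒p≡0 (c (suc v)) (E v at cell v) (E-diag v) (begin
      c (suc v) * (E v at cell v)
        ≡⟨ sym (sum-single (λ u → c (suc u) * (E u at cell v)) v
                 (λ u u≢v → trans (cong (c (suc u) *_) (E-off u v u≢v)) (*-zeroʳ (c (suc u))))) ⟩
      combination (c ∘ suc) E at cell v  ≡⟨ translates≡0 (proj₁ (cell v)) (proj₂ (cell v)) ⟩
      0ℚ                                 ∎)
    c≡0 : ∀ l → c l ≡ 0ℚ
    c≡0 zero    = begin
      c zero                            ≡⟨ sym (+-identityʳ (c zero)) ⟩
      c zero + 0ℚ
        ≡⟨ cong (c zero +_) (sym (trans (sum-cong-≗ {d} c-suc≡0) (sum-replicate-zero d))) ⟩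
      c zero + sum (c ∘ suc)            ≡⟨ sum-c≡0 ⟩
      0ℚ                                ∎
    c≡0 (suc v) = c-suc≡0 v

module Cells where
  open import Data.Empty using (⊥-elim)
  open import Data.Fin using (Fin; toℕ; opposite)
  open import Data.Fin.Properties using (toℕ-injective; toℕ<n; opposite-prop; opposite-involutive)
  open import Data.Nat using (ℕ; suc; _+_; _≤_)
  open import Data.Nat.Properties
    using (<⇒≢; ≤-pred; ≤-total; ≤-antisym; <-cmp; +-comm; +-mono-≤; +-monoʳ-≤; +-cancelʳ-≡; +-cancelʳ-≤;
           m+1+n≰m; m∸n+n≡m; ∸-monoʳ-≤; module ≤-Reasoning)
  open import Data.Nat.Solver using (module +-*-Solver)
  open import Data.Product using (Σ; _×_; _,_; proj₁; proj₂)
  open import Data.Sum using (_⊎_; inj₁; inj₂)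
  open import Function using (_∘_)
  open import Relation.Binary.Definitions using (tri<; tri≈; tri>)
  open import Relation.Binary.PropositionalEquality
  open import Relation.Nullary using (¬_)
  open +-*-Solver using (solve; _:+_; _:=_; con)

  Cell : ℕ → Set
  Cell n = Fin n × Fin n

  transposeCell : ∀ {n} → Cell n → Cell n
  transposeCell x = proj₂ x , proj₁ x

  hankelCell : ∀ {n} → Cell n → Cell n
  hankelCell x = opposite (proj₂ x) , opposite (proj₁ x)

  data InOrbit {n} (x : Cell n) : Cell n → Set where
    itself     : InOrbit x x
    transposed : InOrbit x (transposeCell x)
    hankel     : InOrbit x (hankelCell x)
    rotated    : InOrbit x (transposeCell (hankelCell x))

  OnAntidiagonal : ∀ {n} → Cell n → Set
  OnAntidiagonal x = proj₂ x ≡ opposite (proj₁ x)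

  weight : ∀ {n} → Cell n → ℕ
  weight x = toℕ (proj₁ x) + toℕ (proj₂ x)

  -- i ≤ j and i + j < n - 1: exactly one cell of every orbit that avoids the antidiagonal.
  IsRepresentative : ∀ {n} → Cell n → Set
  IsRepresentative {n} x = toℕ (proj₁ x) ≤ toℕ (proj₂ x) × 2 + weight x ≤ n

  toℕ-opposite+suc : ∀ {n} (i : Fin n) → toℕ (opposite i) + suc (toℕ i) ≡ n
  toℕ-opposite+suc i = trans (cong (_+ suc (toℕ i)) (opposite-prop i)) (m∸n+n≡m (toℕ<n i))

  toℕ-opposite-antimono : ∀ {n} {i j : Fin n} → toℕ i ≤ toℕ j → toℕ (opposite j) ≤ toℕ (opposite i)
  toℕ-opposite-antimono {n} {i} {j} i≤j =
    subst₂ _≤_ (sym (opposite-prop j)) (sym (opposite-prop i)) (∸-monoʳ-≤ n (+-monoʳ-≤ 1 i≤j))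

  opposite-injective : ∀ {n} {i j : Fin n} → opposite i ≡ opposite j → i ≡ j
  opposite-injective {i = i} {j} eq =
    trans (sym (opposite-involutive i)) (trans (cong opposite eq) (opposite-involutive j))

  hankelCell-involutive : ∀ {n} (x : Cell n) → hankelCell (hankelCell x) ≡ x
  hankelCell-involutive (a , c) = cong₂ _,_ (opposite-involutive a) (opposite-involutive c)

  weight-transposeCell : ∀ {n} (x : Cell n) → weight (transposeCell x) ≡ weight x
  weight-transposeCell x = +-comm (toℕ (proj₂ x)) (toℕ (proj₁ x))

  weight-hankelCell : ∀ {n} (x : Cell n) → 2 + (weight (hankelCell x) + weight x) ≡ n + n
  weight-hankelCell {n} (i , j) = begin
    2 + (toℕ (opposite j) + toℕ (opposite i) + (toℕ i + toℕ j))
      ≡⟨ solve 4 (λ j′ i′ i j → con 2 :+ (j′ :+ i′ :+ (i :+ j)) := (i′ :+ (con 1 :+ i)) :+ (j′ :+ (con 1 :+ j))) refl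
                 (toℕ (opposite j)) (toℕ (opposite i)) (toℕ i) (toℕ j) ⟩
    (toℕ (opposite i) + suc (toℕ i)) + (toℕ (opposite j) + suc (toℕ j))
      ≡⟨ cong₂ _+_ (toℕ-opposite+suc i) (toℕ-opposite+suc j) ⟩
    n + n ∎
    where open ≡-Reasoning

  onAntidiagonal⇒weight : ∀ {n} {x : Cell n} → OnAntidiagonal x → suc (weight x) ≡ n
  onAntidiagonal⇒weight {x = i , j} refl = trans (+-comm (suc (toℕ i)) (toℕ (opposite i))) (toℕ-opposite+suc i)

  weight⇒onAntidiagonal : ∀ {n} {x : Cell n} → suc (weight x) ≡ n → OnAntidiagonal x
  weight⇒onAntidiagonal {x = i , j} w≡n = toℕ-injective (+-cancelʳ-≡ (suc (toℕ i)) (toℕ j) (toℕ (opposite i))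
    (trans (trans (+-comm (toℕ j) (suc (toℕ i))) w≡n) (sym (toℕ-opposite+suc i))))

  representative⇒¬onAntidiagonal : ∀ {n} {x : Cell n} → IsRepresentative x → ¬ OnAntidiagonal x
  representative⇒¬onAntidiagonal (_ , 2+w≤n) anti = <⇒≢ 2+w≤n (onAntidiagonal⇒weight anti)

  onAntidiagonal-orbit : ∀ {n} {x y : Cell n} → OnAntidiagonal x → InOrbit x y → OnAntidiagonal y
  onAntidiagonal-orbit {x = i , _} refl itself     = refl
  onAntidiagonal-orbit {x = i , _} refl transposed = sym (opposite-involutive i)
  onAntidiagonal-orbit {x = i , _} refl hankel     = sym (opposite-involutive (opposite i))
  onAntidiagonal-orbit {x = i , _} refl rotated    = refl

  -- Hankel transposition reflects the weight about n - 1 (weight-hankelCell), so it never maps a cell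
  -- strictly above the antidiagonal to another such cell.
  hankel-weights : ∀ {n} (a b : ℕ) → 2 + a ≤ n → 2 + b ≤ n → 2 + (a + b) ≢ n + n
  hankel-weights {n} a b 2+a≤n 2+b≤n a+b≡ = m+1+n≰m (2 + (a + b)) {1} (begin
    2 + (a + b) + 2      ≡⟨ solve 2 (λ a b → con 2 :+ (a :+ b) :+ con 2 := (con 2 :+ a) :+ (con 2 :+ b)) refl a b ⟩
    (2 + a) + (2 + b)    ≤⟨ +-mono-≤ 2+a≤n 2+b≤n ⟩
    n + n                ≡⟨ sym a+b≡ ⟩
    2 + (a + b)          ∎)
    where open ≤-Reasoning

  representative-unique : ∀ {n} {x y : Cell n} → IsRepresentative x → IsRepresentative y → InOrbit x y → y ≡ x
  representative-unique _ _ itself = refl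
  representative-unique {x = i , j} (i≤j , _) (j≤i , _) transposed =
    cong₂ _,_ (sym i≡j) i≡j
    where i≡j = toℕ-injective (≤-antisym i≤j j≤i)
  representative-unique {x = x} (_ , 2+wx≤n) (_ , 2+wy≤n) hankel =
    ⊥-elim (hankel-weights _ _ 2+wy≤n 2+wx≤n (weight-hankelCell x))
  representative-unique {n} {x = x} (_ , 2+wx≤n) (_ , 2+wy≤n) rotated =
    ⊥-elim (hankel-weights _ _ (subst (λ w → 2 + w ≤ n) (weight-transposeCell (hankelCell x)) 2+wy≤n) 2+wx≤n
                           (weight-hankelCell x))

  representativeOfOrdered : ∀ {n} (x : Cell n) → toℕ (proj₁ x) ≤ toℕ (proj₂ x) → suc (weight x) ≢ n →
    Σ (Cell n) λ y → IsRepresentative y × (y ≡ x ⊎ y ≡ hankelCell x)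
  representativeOfOrdered {n} x ordered off with <-cmp (suc (weight x)) n
  ... | tri< below _ _ = x , (ordered , below) , inj₁ refl
  ... | tri≈ _ on _    = ⊥-elim (off on)
  ... | tri> _ _ above = hankelCell x , (toℕ-opposite-antimono ordered , hankelBelow) , inj₂ refl
    where
    open ≤-Reasoning
    hankelBelow : 2 + weight (hankelCell x) ≤ n
    hankelBelow = +-cancelʳ-≤ n (2 + weight (hankelCell x)) n (begin
      2 + weight (hankelCell x) + n            ≤⟨ +-monoʳ-≤ (2 + weight (hankelCell x)) (≤-pred above) ⟩
      2 + weight (hankelCell x) + weight x     ≡⟨ weight-hankelCell x ⟩
      n + n                                    ∎)

  representative : ∀ {n} (x : Cell n) → ¬ OnAntidiagonal x → Σ (Cell n) λ y → IsRepresentative y × InOrbit x y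
  representative x off with ≤-total (toℕ (proj₁ x)) (toℕ (proj₂ x))
  ... | inj₁ ordered with representativeOfOrdered x ordered (off ∘ weight⇒onAntidiagonal)
  ...   | y , rep , inj₁ refl = y , rep , itself
  ...   | y , rep , inj₂ refl = y , rep , hankel
  representative x off | inj₂ reversed
      with representativeOfOrdered (transposeCell x) reversed
             (off ∘ weight⇒onAntidiagonal ∘ trans (cong suc (sym (weight-transposeCell x))))
  ...   | y , rep , inj₁ refl = y , rep , transposed
  ...   | y , rep , inj₂ refl = y , rep , rotated

module BalancedMatrices where
  open import Data.Fin using (opposite)
  open import Data.Fin.Properties using (_≟_)
  open import Data.Product using (_,_)
  open import Data.Rational using (ℚ; 0ℚ; _*_)
  open import Data.Rational.Properties using (*-zeroʳ)
  open import Defs using (Mat; transpose; hankelTranspose)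
  open import Relation.Binary.PropositionalEquality
  open import Relation.Nullary using (¬_; yes; no)
  open Sums
  open AffineDimension
  open Cells

  record Balanced {n} (D : Mat n) : Set where
    field
      symmetric       : ∀ i j → transpose D i j ≡ D i j
      hankelSymmetric : ∀ i j → hankelTranspose D i j ≡ D i j
      rowSum≡0        : ∀ i → sum (D i) ≡ 0ℚ

  module _ {n} {D : Mat n} (balanced : Balanced D) where
    open Balanced balanced

    balanced-orbit : ∀ {x y} → InOrbit x y → D at y ≡ D at x
    balanced-orbit {i , j} itself     = refl
    balanced-orbit {i , j} transposed = symmetric i j
    balanced-orbit {i , j} hankel     = hankelSymmetric i j
    balanced-orbit {i , j} rotated    = trans (symmetric (opposite j) (opposite i)) (hankelSymmetric i j)

    private
      vanishing-offAntidiagonal : (∀ x → IsRepresentative x → D at x ≡ 0ℚ) →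
                                  ∀ x → ¬ OnAntidiagonal x → D at x ≡ 0ℚ
      vanishing-offAntidiagonal vanish x off with representative x off
      ... | y , rep , x∼y = trans (sym (balanced-orbit x∼y)) (vanish y rep)

    balanced-vanishing : (∀ x → IsRepresentative x → D at x ≡ 0ℚ) → ∀ i j → D i j ≡ 0ℚ
    balanced-vanishing vanish i j with j ≟ opposite i
    ... | no  j≢i′ = vanishing-offAntidiagonal vanish (i , j) j≢i′
    ... | yes refl =
      trans (sym (sum-single (D i) (opposite i) (λ j j≢i′ → vanishing-offAntidiagonal vanish (i , j) j≢i′)))
            (rowSum≡0 i)

  balanced-scale : ∀ {n} (s : ℚ) {D : Mat n} → Balanced D → Balanced (λ i j → s * D i j)
  balanced-scale s {D} balanced = record
    { symmetric       = λ i j → cong (s *_) (symmetric i j)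
    ; hankelSymmetric = λ i j → cong (s *_) (hankelSymmetric i j)
    ; rowSum≡0        = λ i → trans (sym (*-distribˡ-sum s (D i))) (trans (cong (s *_) (rowSum≡0 i)) (*-zeroʳ s))
    }
    where open Balanced balanced

module Witnesses where
  open import Data.Empty using (⊥-elim)
  open import Data.Fin using (Fin; zero; suc; opposite)
  open import Data.Fin.Properties using (_≟_; opposite-involutive)
  open import Data.Integer as ℤ using (+≤+; +<+)
  open import Data.Nat using (z≤n; s≤s)
  open import Data.Product using (_×_; _,_; proj₁; proj₂)
  open import Data.Rational using (ℚ; 0ℚ; 1ℚ; _+_; _*_; _-_; -_; _/_; _≤_; _<_; *≤*; *<*)
  open import Data.Rational.Properties
    using (*-comm; *-identityˡ; *-identityʳ; *-zeroˡ; *-zeroʳ; +-identityʳ; +-inverseʳ;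
           ≤-refl; ≤-reflexive; ≤-trans; <-≤-trans; +-mono-≤; +-monoˡ-≤)
  open import Data.Rational.Solver using (module +-*-Solver)
  open import Defs using (Mat; transpose; hankelTranspose)
  open import Function using (_∘_)
  open import Relation.Binary.PropositionalEquality
  open import Relation.Nullary using (¬_; yes; no)
  open Sums
  open AffineDimension
  open Cells
  open BalancedMatrices
  open +-*-Solver using (solve; _:+_; _:-_; _:=_; con)
  open ≡-Reasoning

  four : ℚ
  four = ℤ.+ 4 / 1

  eight : ℚ
  eight = four + four

  0≤1 : 0ℚ ≤ 1ℚ
  0≤1 = *≤* (+≤+ z≤n)

  δ : ∀ {n} → Fin n → Fin n → ℚ
  δ zero    zero    = 1ℚ
  δ zero    (suc _) = 0ℚ
  δ (suc _) zero    = 0ℚ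
  δ (suc i) (suc j) = δ i j

  δ-refl : ∀ {n} (i : Fin n) → δ i i ≡ 1ℚ
  δ-refl zero    = refl
  δ-refl (suc i) = δ-refl i

  δ-≢ : ∀ {n} {i j : Fin n} → i ≢ j → δ i j ≡ 0ℚ
  δ-≢ {i = zero}  {zero}  i≢j = ⊥-elim (i≢j refl)
  δ-≢ {i = zero}  {suc j} _   = refl
  δ-≢ {i = suc i} {zero}  _   = refl
  δ-≢ {i = suc i} {suc j} i≢j = δ-≢ (i≢j ∘ cong suc)

  0≤δ : ∀ {n} (i j : Fin n) → 0ℚ ≤ δ i j
  0≤δ zero    zero    = 0≤1
  0≤δ zero    (suc _) = ≤-refl
  0≤δ (suc _) zero    = ≤-refl
  0≤δ (suc i) (suc j) = 0≤δ i j

  δ≤1 : ∀ {n} (i j : Fin n) → δ i j ≤ 1ℚ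
  δ≤1 zero    zero    = ≤-refl
  δ≤1 zero    (suc _) = 0≤1
  δ≤1 (suc _) zero    = 0≤1
  δ≤1 (suc i) (suc j) = δ≤1 i j

  δ-opposite : ∀ {n} (i j : Fin n) → δ (opposite i) j ≡ δ i (opposite j)
  δ-opposite i j with i ≟ opposite j
  ... | yes refl = trans (cong (λ k → δ k j) (opposite-involutive j)) (trans (δ-refl j) (sym (δ-refl (opposite j))))
  ... | no  i≢j′ = trans (δ-≢ (λ i′≡j → i≢j′ (trans (sym (opposite-involutive i)) (cong opposite i′≡j))))
                         (sym (δ-≢ i≢j′))

  sum-δ : ∀ {n} (c : Fin n) → sum (λ j → δ j c) ≡ 1ℚ
  sum-δ c = trans (sum-single (λ j → δ j c) c (λ j → δ-≢)) (δ-refl c)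

  unit : ∀ {n} → Cell n → Mat n
  unit x i j = δ i (proj₁ x) * δ j (proj₂ x)

  unit-off : ∀ {n} {x y : Cell n} → y ≢ x → unit x at y ≡ 0ℚ
  unit-off {x = a , c} {y = i , j} y≢x with i ≟ a | j ≟ c
  ... | no  i≢a  | _        = trans (cong (_* δ j c) (δ-≢ i≢a)) (*-zeroˡ (δ j c))
  ... | yes _    | no  j≢c  = trans (cong (δ i a *_) (δ-≢ j≢c)) (*-zeroʳ (δ i a))
  ... | yes refl | yes refl = ⊥-elim (y≢x refl)

  unit-self : ∀ {n} (x : Cell n) → unit x at x ≡ 1ℚ
  unit-self (a , c) = cong₂ _*_ (δ-refl a) (δ-refl c)

  unit-bounds : ∀ {n} (x : Cell n) i j → 0ℚ ≤ unit x i j × unit x i j ≤ 1ℚ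
  unit-bounds (a , c) i j with i ≟ a
  ... | no  i≢a  = subst (λ u → 0ℚ ≤ u × u ≤ 1ℚ) (sym (trans (cong (_* δ j c) (δ-≢ i≢a)) (*-zeroˡ (δ j c))))
                         (≤-refl , 0≤1)
  ... | yes refl = subst (λ u → 0ℚ ≤ u × u ≤ 1ℚ) (sym (trans (cong (_* δ j c) (δ-refl i)) (*-identityˡ (δ j c))))
                         (0≤δ j c , δ≤1 j c)

  unit-rowSum : ∀ {n} (x : Cell n) i → sum (unit x i) ≡ δ i (proj₁ x)
  unit-rowSum (a , c) i = begin
    sum (λ j → δ i a * δ j c)   ≡⟨ sym (*-distribˡ-sum (δ i a) (λ j → δ j c)) ⟩
    δ i a * sum (λ j → δ j c)   ≡⟨ cong (δ i a *_) (sum-δ c) ⟩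
    δ i a * 1ℚ                  ≡⟨ *-identityʳ (δ i a) ⟩
    δ i a                       ∎

  unit-transpose : ∀ {n} (x : Cell n) i j → transpose (unit x) i j ≡ unit (transposeCell x) i j
  unit-transpose (a , c) i j = *-comm (δ j a) (δ i c)

  unit-hankelTranspose : ∀ {n} (x : Cell n) i j → hankelTranspose (unit x) i j ≡ unit (hankelCell x) i j
  unit-hankelTranspose (a , c) i j =
    trans (cong₂ _*_ (δ-opposite j a) (δ-opposite i c)) (*-comm (δ j (opposite a)) (δ i (opposite c)))

  orbitMatrix : ∀ {n} → Cell n → Mat n
  orbitMatrix x i j = unit x i j + unit (transposeCell x) i j + unit (hankelCell x) i j
                    + unit (transposeCell (hankelCell x)) i j

  orbitMatrix-symmetric : ∀ {n} (x : Cell n) i j → transpose (orbitMatrix x) i j ≡ orbitMatrix x i j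
  orbitMatrix-symmetric x i j = begin
    u x j i + u (τ x) j i + u (η x) j i + u (τ (η x)) j i
      ≡⟨ cong₂ _+_ (cong₂ _+_ (cong₂ _+_ (unit-transpose x i j) (unit-transpose (τ x) i j))
                              (unit-transpose (η x) i j)) (unit-transpose (τ (η x)) i j) ⟩
    u (τ x) i j + u x i j + u (τ (η x)) i j + u (η x) i j
      ≡⟨ solve 4 (λ a b c d → b :+ a :+ d :+ c := a :+ b :+ c :+ d) refl
                 (u x i j) (u (τ x) i j) (u (η x) i j) (u (τ (η x)) i j) ⟩
    orbitMatrix x i j ∎
    where u = unit; τ = transposeCell; η = hankelCell

  orbitMatrix-hankelSymmetric : ∀ {n} (x : Cell n) i j → hankelTranspose (orbitMatrix x) i j ≡ orbitMatrix x i j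
  orbitMatrix-hankelSymmetric x i j = begin
    u x j′ i′ + u (τ x) j′ i′ + u (η x) j′ i′ + u (τ (η x)) j′ i′
      ≡⟨ cong₂ _+_ (cong₂ _+_ (cong₂ _+_ (unit-hankelTranspose x i j) (unit-hankelTranspose (τ x) i j))
                              (unit-hankelTranspose (η x) i j)) (unit-hankelTranspose (τ (η x)) i j) ⟩
    u (η x) i j + u (τ (η x)) i j + u (η (η x)) i j + u (τ (η (η x))) i j
      ≡⟨ cong₂ _+_ (cong (u (η x) i j + u (τ (η x)) i j +_) (cong (λ y → u y i j) (hankelCell-involutive x)))
                   (cong (λ y → u (τ y) i j) (hankelCell-involutive x)) ⟩
    u (η x) i j + u (τ (η x)) i j + u x i j + u (τ x) i j
      ≡⟨ solve 4 (λ a b c d → c :+ d :+ a :+ b := a :+ b :+ c :+ d) refl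
                 (u x i j) (u (τ x) i j) (u (η x) i j) (u (τ (η x)) i j) ⟩
    orbitMatrix x i j ∎
    where u = unit; τ = transposeCell; η = hankelCell; i′ = opposite i; j′ = opposite j

  orbitMatrix-rowSum : ∀ {n} (x : Cell n) i →
    sum (orbitMatrix x i) ≡ δ i (proj₁ x) + δ i (proj₂ x) + δ i (opposite (proj₂ x)) + δ i (opposite (proj₁ x))
  orbitMatrix-rowSum x i = begin
    sum (λ j → u x i j + u (τ x) i j + u (η x) i j + u (τ (η x)) i j)
      ≡⟨ ∑-distrib-+ (λ j → u x i j + u (τ x) i j + u (η x) i j) (u (τ (η x)) i) ⟩
    sum (λ j → u x i j + u (τ x) i j + u (η x) i j) + sum (u (τ (η x)) i)
      ≡⟨ cong (_+ sum (u (τ (η x)) i)) (trans (∑-distrib-+ (λ j → u x i j + u (τ x) i j) (u (η x) i))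
           (cong (_+ sum (u (η x) i)) (∑-distrib-+ (u x i) (u (τ x) i)))) ⟩
    sum (u x i) + sum (u (τ x) i) + sum (u (η x) i) + sum (u (τ (η x)) i)
      ≡⟨ cong₂ _+_ (cong₂ _+_ (cong₂ _+_ (unit-rowSum x i) (unit-rowSum (τ x) i)) (unit-rowSum (η x) i))
                   (unit-rowSum (τ (η x)) i) ⟩
    δ i (proj₁ x) + δ i (proj₂ x) + δ i (opposite (proj₂ x)) + δ i (opposite (proj₁ x)) ∎
    where u = unit; τ = transposeCell; η = hankelCell

  orbitMatrix-off : ∀ {n} {x y : Cell n} → ¬ InOrbit x y → orbitMatrix x at y ≡ 0ℚ
  orbitMatrix-off {x = x} {y} y∉orbit = cong₂ _+_ (cong₂ _+_ (cong₂ _+_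
    (unit-off {x = x} {y} (λ { refl → y∉orbit itself }))
    (unit-off {x = transposeCell x} {y} (λ { refl → y∉orbit transposed })))
    (unit-off {x = hankelCell x} {y} (λ { refl → y∉orbit hankel })))
    (unit-off {x = transposeCell (hankelCell x)} {y} (λ { refl → y∉orbit rotated }))

  orbitMatrix-bounds : ∀ {n} (x : Cell n) i j → 0ℚ ≤ orbitMatrix x i j × orbitMatrix x i j ≤ four
  orbitMatrix-bounds x i j =
    +-mono-≤ (+-mono-≤ (+-mono-≤ (proj₁ (b x)) (proj₁ (b (τ x)))) (proj₁ (b (η x)))) (proj₁ (b (τ (η x)))) ,
    +-mono-≤ (+-mono-≤ (+-mono-≤ (proj₂ (b x)) (proj₂ (b (τ x)))) (proj₂ (b (η x)))) (proj₂ (b (τ (η x))))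
    where b = λ y → unit-bounds y i j; τ = transposeCell; η = hankelCell

  1≤orbitMatrix-self : ∀ {n} (x : Cell n) → 1ℚ ≤ orbitMatrix x at x
  1≤orbitMatrix-self x =
    +-mono-≤ (+-mono-≤ (+-mono-≤ (≤-reflexive (sym (unit-self x))) (proj₁ (b (τ x)))) (proj₁ (b (η x))))
             (proj₁ (b (τ (η x))))
    where b = λ y → unit-bounds y (proj₁ x) (proj₂ x); τ = transposeCell; η = hankelCell

  antidiagonalCell : ∀ {n} → Fin n → Cell n
  antidiagonalCell a = a , opposite a

  antidiagonalOrbit-rowSum : ∀ {n} (a : Fin n) i →
    sum (orbitMatrix (antidiagonalCell a) i) ≡ δ i a + δ i (opposite a) + δ i a + δ i (opposite a)
  antidiagonalOrbit-rowSum a i = trans (orbitMatrix-rowSum (antidiagonalCell a) i)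
    (cong (λ t → δ i a + δ i (opposite a) + t + δ i (opposite a)) (cong (δ i) (opposite-involutive a)))

  antidiagonalOrbit-vanishes : ∀ {n} (a : Fin n) {y : Cell n} → IsRepresentative y →
                               orbitMatrix (antidiagonalCell a) at y ≡ 0ℚ
  antidiagonalOrbit-vanishes a rep =
    orbitMatrix-off (representative⇒¬onAntidiagonal rep ∘ onAntidiagonal-orbit refl)

  -- The antidiagonal orbit matrices of the rows of x cancel the row sums of twice the orbit matrix of x.
  witness : ∀ {n} → Cell n → Mat n
  witness x i j = orbitMatrix x i j + orbitMatrix x i j
                - orbitMatrix (antidiagonalCell (proj₁ x)) i j - orbitMatrix (antidiagonalCell (proj₂ x)) i j

  private
    twice-minus-cong : ∀ {p q r p′ q′ r′ : ℚ} → p ≡ p′ → q ≡ q′ → r ≡ r′ → p + p - q - r ≡ p′ + p′ - q′ - r′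
    twice-minus-cong refl refl refl = refl

  witness-balanced : ∀ {n} (x : Cell n) → Balanced (witness x)
  witness-balanced x = record
    { symmetric       = λ i j → twice-minus-cong (orbitMatrix-symmetric x i j)
                                  (orbitMatrix-symmetric (antidiagonalCell a) i j)
                                  (orbitMatrix-symmetric (antidiagonalCell c) i j)
    ; hankelSymmetric = λ i j → twice-minus-cong (orbitMatrix-hankelSymmetric x i j)
                                  (orbitMatrix-hankelSymmetric (antidiagonalCell a) i j)
                                  (orbitMatrix-hankelSymmetric (antidiagonalCell c) i j)
    ; rowSum≡0        = rowSum≡0
    }
    where
    a = proj₁ x
    c = proj₂ x
    rowSum≡0 : ∀ i → sum (witness x i) ≡ 0ℚ
    rowSum≡0 i = begin
      sum (witness x i)
        ≡⟨ trans (∑-distrib-- (λ j → O x i j + O x i j - A i j) (C i))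
                 (cong (_- sum (C i)) (trans (∑-distrib-- (λ j → O x i j + O x i j) (A i))
                   (cong (_- sum (A i)) (∑-distrib-+ (O x i) (O x i))))) ⟩
      sum (O x i) + sum (O x i) - sum (A i) - sum (C i)
        ≡⟨ twice-minus-cong (orbitMatrix-rowSum x i) (antidiagonalOrbit-rowSum a i) (antidiagonalOrbit-rowSum c i) ⟩
      (δa + δc + δc′ + δa′) + (δa + δc + δc′ + δa′) - (δa + δa′ + δa + δa′) - (δc + δc′ + δc + δc′)
        ≡⟨ solve 4 (λ a c c′ a′ → (a :+ c :+ c′ :+ a′) :+ (a :+ c :+ c′ :+ a′) :- (a :+ a′ :+ a :+ a′)
                                    :- (c :+ c′ :+ c :+ c′) := con 0ℚ) refl δa δc δc′ δa′ ⟩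
      0ℚ ∎
      where
      O = orbitMatrix
      A = orbitMatrix (antidiagonalCell a)
      C = orbitMatrix (antidiagonalCell c)
      δa = δ i a
      δc = δ i c
      δa′ = δ i (opposite a)
      δc′ = δ i (opposite c)

  witness-off : ∀ {n} {x y : Cell n} → IsRepresentative x → IsRepresentative y → y ≢ x → witness x at y ≡ 0ℚ
  witness-off {x = x} repx repy y≢x =
    twice-minus-cong Ox≡0 (antidiagonalOrbit-vanishes (proj₁ x) repy) (antidiagonalOrbit-vanishes (proj₂ x) repy)
    where Ox≡0 = orbitMatrix-off (y≢x ∘ representative-unique repx repy)

  0<witness-self : ∀ {n} {x : Cell n} → IsRepresentative x → 0ℚ < witness x at x
  0<witness-self {x = x} rep =
    <-≤-trans 0<2 (≤-trans (+-mono-≤ (1≤orbitMatrix-self x) (1≤orbitMatrix-self x)) (≤-reflexive (sym witness≡)))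
    where
    O = orbitMatrix x at x
    0<2 : 0ℚ < 1ℚ + 1ℚ
    0<2 = *<* (+<+ (s≤s z≤n))
    witness≡ : witness x at x ≡ O + O
    witness≡ = trans (twice-minus-cong {p = O} refl (antidiagonalOrbit-vanishes (proj₁ x) rep)
                                                    (antidiagonalOrbit-vanishes (proj₂ x) rep))
                     (trans (+-identityʳ (O + O - 0ℚ)) (+-identityʳ (O + O)))

  witness-lowerBound : ∀ {n} (x : Cell n) i j → 0ℚ ≤ eight + witness x i j
  witness-lowerBound x i j = subst (0ℚ ≤_)
    (solve 3 (λ o p q → o :+ o :+ ((con four :- p) :+ (con four :- q)) := con eight :+ (o :+ o :- p :- q))
             refl (O x) (O (antidiagonalCell (proj₁ x))) (O (antidiagonalCell (proj₂ x))))
    (+-mono-≤ (+-mono-≤ (proj₁ (bounds x)) (proj₁ (bounds x)))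
              (+-mono-≤ (0≤q-p (proj₂ (bounds (antidiagonalCell (proj₁ x)))))
                        (0≤q-p (proj₂ (bounds (antidiagonalCell (proj₂ x)))))))
    where
    O = λ y → orbitMatrix y i j
    bounds = λ y → orbitMatrix-bounds y i j
    0≤q-p : ∀ {p q} → p ≤ q → 0ℚ ≤ q - p
    0≤q-p {p} {q} p≤q = subst (_≤ q - p) (+-inverseʳ p) (+-monoˡ-≤ (- p) p≤q)

module DoublyStochastic where
  open import Algebra.Bundles using (Ring)
  open import Data.Fin using (Fin)
  open import Data.Product using (_,_; proj₁; proj₂)
  open import Data.Nat as ℕ using (zero; suc; z≤n; s≤s)
  open import Data.Rational using (ℚ; 0ℚ; 1ℚ; _+_; _*_; _≤_; _<_)
  open import Data.Rational.Properties using (+-*-ring; *-identityʳ; +-identityʳ; +-mono-<)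
  open import Defs
  open import Relation.Binary.PropositionalEquality
  open import Algebra.Properties.Semiring.Mult (Ring.semiring +-*-ring) using () renaming (_×_ to _times_)
  open Sums
  open AffineDimension
  open BalancedMatrices

  rowSum-Ω : ∀ {n} {A : Mat n} → InΩth A → ∀ i → sum (A i) ≡ 1ℚ
  rowSum-Ω {A = A} ((_ , rows , _) , _) i = trans (sym (Σ≡sum (A i))) (rows i)

  balanced-combination : ∀ {n k} (c : Fin k → ℚ) (P : Fin k → Mat n) → (∀ l → InΩth (P l)) → sum c ≡ 0ℚ →
                         Balanced (combination c P)
  balanced-combination {n} {k} c P P∈Ω sum-c≡0 = record
    { symmetric       = λ i j → sum-cong-≗ {k} (λ l → cong (c l *_) (proj₁ (proj₂ (P∈Ω l)) i j))
    ; hankelSymmetric = λ i j → sum-cong-≗ {k} (λ l → cong (c l *_) (proj₂ (proj₂ (P∈Ω l)) i j))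
    ; rowSum≡0        = rowSum≡0
    }
    where
    rowSum≡0 : ∀ i → sum (combination c P i) ≡ 0ℚ
    rowSum≡0 i = begin
      sum (λ j → sum (λ l → c l * P l i j))   ≡⟨ ∑-comm (λ j l → c l * P l i j) ⟩
      sum (λ l → sum (λ j → c l * P l i j))   ≡⟨ sum-cong-≗ {k} (λ l → sym (*-distribˡ-sum (c l) (P l i))) ⟩
      sum (λ l → c l * sum (P l i))
        ≡⟨ sum-cong-≗ {k} (λ l → trans (cong (c l *_) (rowSum-Ω (P∈Ω l) i)) (*-identityʳ (c l))) ⟩
      sum c                                   ≡⟨ sum-c≡0 ⟩
      0ℚ                                      ∎
      where open ≡-Reasoning

  InΩth-translate : ∀ {n} {P E : Mat n} → InΩth P → Balanced E → (∀ i j → 0ℚ ≤ P i j + E i j) →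
                    InΩth (λ i j → P i j + E i j)
  InΩth-translate {n} {P} {E} P∈Ω@(_ , symP , hankP) balanced nonneg =
    (nonneg , rows , columns) , symmetric′ , hankel′
    where
    open Balanced balanced
    symmetric′ = λ i j → cong₂ _+_ (symP i j) (symmetric i j)
    hankel′    = λ i j → cong₂ _+_ (hankP i j) (hankelSymmetric i j)
    rows : ∀ i → Σ[ (λ j → P i j + E i j) ] ≡ 1ℚ
    rows i = begin
      Σ[ (λ j → P i j + E i j) ]     ≡⟨ Σ≡sum (λ j → P i j + E i j) ⟩
      sum (λ j → P i j + E i j)      ≡⟨ ∑-distrib-+ (P i) (E i) ⟩
      sum (P i) + sum (E i)          ≡⟨ cong₂ _+_ (rowSum-Ω P∈Ω i) (rowSum≡0 i) ⟩
      1ℚ                             ∎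
      where open ≡-Reasoning
    columns : ∀ j → Σ[ (λ i → P i j + E i j) ] ≡ 1ℚ
    columns j = begin
      Σ[ (λ i → P i j + E i j) ]   ≡⟨ Σ≡sum (λ i → P i j + E i j) ⟩
      sum (λ i → P i j + E i j)    ≡⟨ sum-cong-≗ {n} (symmetric′ j) ⟩
      sum (λ i → P j i + E j i)    ≡⟨ sym (Σ≡sum (λ i → P j i + E j i)) ⟩
      Σ[ (λ i → P j i + E j i) ]   ≡⟨ rows j ⟩
      1ℚ                           ∎
      where open ≡-Reasoning

  InΩth-constant : ∀ {n} {κ : ℚ} → 0ℚ ≤ κ → n times κ ≡ 1ℚ → InΩth (λ (_ _ : Fin n) → κ)
  InΩth-constant {n} {κ} 0≤κ nκ≡1 =
    ((λ _ _ → 0≤κ) , (λ _ → constantSum) , (λ _ → constantSum)) , (λ _ _ → refl) , (λ _ _ → refl)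
    where
    constantSum : Σ[ (λ (_ : Fin n) → κ) ] ≡ 1ℚ
    constantSum = trans (Σ≡sum {n} (λ _ → κ)) (trans (sum-replicate n {κ}) nκ≡1)

  0<times : ∀ {k x} → 1 ℕ.≤ k → 0ℚ < x → 0ℚ < k times x
  0<times {suc zero}    {x} _ 0<x = subst (0ℚ <_) (sym (+-identityʳ x)) 0<x
  0<times {suc (suc k)} {x} _ 0<x = +-mono-< 0<x (0<times {suc k} (s≤s z≤n) 0<x)

import Data.Nat as ℕ

module Representatives (m b : ℕ.ℕ) (b≤1 : b ℕ.≤ 1) where
  open import Data.Empty using (⊥-elim)
  open import Data.Fin using (Fin; toℕ; fromℕ<; inject≤; opposite)
  open import Data.Fin.Properties
    using (toℕ-injective; toℕ<n; toℕ-inject≤; toℕ-fromℕ<; inject≤-injective; opposite-involutive)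
  open import Data.Nat using (ℕ; suc; s≤s; _+_; _≤_; _<_; _≤?_; _<?_)
  open import Data.Nat.Properties
    using (≤-trans; <-trans; ≤-pred; <⇒≤; <⇒≱; ≰⇒>; ≮⇒≥; m≤m+n; +-comm; +-assoc; +-suc; +-mono-≤; +-monoʳ-≤;
           +-monoˡ-≤; +-cancelʳ-≤; module ≤-Reasoning)
  open import Data.Product using (Σ; _,_; proj₁; proj₂)
  open import Relation.Binary.PropositionalEquality
  open import Relation.Nullary using (yes; no)
  open Cells

  N : ℕ
  N = m + m + b

  m+b+m≡N : m + b + m ≡ N
  m+b+m≡N = trans (+-assoc m b m) (trans (cong (m +_) (+-comm b m)) (sym (+-assoc m m b)))

  m+b≤N : m + b ≤ N
  m+b≤N = subst (m + b ≤_) m+b+m≡N (m≤m+n (m + b) m)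

  m≤N : m ≤ N
  m≤N = ≤-trans (m≤m+n m b) m+b≤N

  cell : Fin m → Fin (m + b) → Cell N
  cell p r with toℕ p ≤? toℕ r
  ... | yes _ = inject≤ p m≤N , inject≤ r m+b≤N
  ... | no  _ = inject≤ r m+b≤N , opposite (inject≤ p m≤N)

  data CellShape (p : Fin m) (r : Fin (m + b)) : Cell N → Set where
    upper : toℕ p ≤ toℕ r → CellShape p r (inject≤ p m≤N , inject≤ r m+b≤N)
    lower : toℕ r < toℕ p → CellShape p r (inject≤ r m+b≤N , opposite (inject≤ p m≤N))

  cellShape : ∀ p r → CellShape p r (cell p r)
  cellShape p r with toℕ p ≤? toℕ r
  ... | yes p≤r = upper p≤r
  ... | no  p≰r = lower (≰⇒> p≰r)

  m+b≤opposite : ∀ (p : Fin m) → m + b ≤ toℕ (opposite (inject≤ p m≤N))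
  m+b≤opposite p = +-cancelʳ-≤ m (m + b) (toℕ (opposite p′)) (begin
    m + b + m                        ≡⟨ m+b+m≡N ⟩
    N                                ≡⟨ sym (toℕ-opposite+suc p′) ⟩
    toℕ (opposite p′) + suc (toℕ p′)
      ≤⟨ +-monoʳ-≤ (toℕ (opposite p′)) (subst (λ k → suc k ≤ m) (sym (toℕ-inject≤ p m≤N)) (toℕ<n p)) ⟩
    toℕ (opposite p′) + m            ∎)
    where
    open ≤-Reasoning
    p′ = inject≤ p m≤N

  cell-representative : ∀ p r → IsRepresentative (cell p r)
  cell-representative p r with cell p r | cellShape p r
  ... | _ | upper p≤r = subst₂ _≤_ (sym (toℕ-inject≤ p m≤N)) (sym (toℕ-inject≤ r m+b≤N)) p≤r , below
    where
    open ≤-Reasoning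
    below : 2 + (toℕ (inject≤ p m≤N) + toℕ (inject≤ r m+b≤N)) ≤ N
    below = begin
      2 + (toℕ (inject≤ p m≤N) + toℕ (inject≤ r m+b≤N))
        ≡⟨ cong₂ (λ s t → 2 + (s + t)) (toℕ-inject≤ p m≤N) (toℕ-inject≤ r m+b≤N) ⟩
      suc (suc (toℕ p + toℕ r))   ≡⟨ cong suc (sym (+-suc (toℕ p) (toℕ r))) ⟩
      suc (toℕ p) + suc (toℕ r)   ≤⟨ +-mono-≤ (toℕ<n p) (toℕ<n r) ⟩
      m + (m + b)                 ≡⟨ sym (+-assoc m m b) ⟩
      N                           ∎
  ... | _ | lower r<p = ordered , below
    where
    open ≤-Reasoning
    o = toℕ (opposite (inject≤ p m≤N))
    ordered : toℕ (inject≤ r m+b≤N) ≤ o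
    ordered = ≤-trans (<⇒≤ (subst (_< m + b) (sym (toℕ-inject≤ r m+b≤N)) (toℕ<n r))) (m+b≤opposite p)
    below : 2 + (toℕ (inject≤ r m+b≤N) + o) ≤ N
    below = begin
      2 + (toℕ (inject≤ r m+b≤N) + o)    ≡⟨ cong (λ s → 2 + (s + o)) (toℕ-inject≤ r m+b≤N) ⟩
      suc (suc (toℕ r)) + o              ≤⟨ +-monoˡ-≤ o (s≤s r<p) ⟩
      suc (toℕ p) + o                    ≡⟨ +-comm (suc (toℕ p)) o ⟩
      o + suc (toℕ p)                    ≡⟨ cong (λ s → o + suc s) (sym (toℕ-inject≤ p m≤N)) ⟩
      o + suc (toℕ (inject≤ p m≤N))      ≡⟨ toℕ-opposite+suc (inject≤ p m≤N) ⟩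
      N                                  ∎

  private
    upper≢lower : ∀ (r : Fin (m + b)) (p : Fin m) → inject≤ r m+b≤N ≢ opposite (inject≤ p m≤N)
    upper≢lower r p eq = <⇒≱ (subst (_< m + b) (trans (sym (toℕ-inject≤ r m+b≤N)) (cong toℕ eq)) (toℕ<n r))
                             (m+b≤opposite p)

  cell-injective : ∀ {p p′ r r′} → cell p r ≡ cell p′ r′ → (p , r) ≡ (p′ , r′)
  cell-injective {p} {p′} {r} {r′} eq with cell p r | cellShape p r | cell p′ r′ | cellShape p′ r′
  ... | _ | upper _ | _ | upper _ =
    cong₂ _,_ (inject≤-injective m≤N m≤N p p′ (cong proj₁ eq))
              (inject≤-injective m+b≤N m+b≤N r r′ (cong proj₂ eq))
  ... | _ | lower _ | _ | lower _ =
    cong₂ _,_ (inject≤-injective m≤N m≤N p p′ (opposite-injective (cong proj₂ eq)))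
              (inject≤-injective m+b≤N m+b≤N r r′ (cong proj₁ eq))
  ... | _ | upper _ | _ | lower _ = ⊥-elim (upper≢lower r p′ (cong proj₂ eq))
  ... | _ | lower _ | _ | upper _ = ⊥-elim (upper≢lower r′ p (sym (cong proj₂ eq)))

  cell-surjective : ∀ {x} → IsRepresentative x → Σ (Fin m) λ p → Σ (Fin (m + b)) λ r → cell p r ≡ x
  cell-surjective {i , j} (i≤j , below) with toℕ j <? m + b
  ... | yes j<m+b = p , r , p,r↦x
    where
    open ≤-Reasoning
    i+i<m+m : toℕ i + toℕ i < m + m
    i+i<m+m = ≤-pred (begin
      2 + (toℕ i + toℕ i)   ≤⟨ +-monoʳ-≤ 2 (+-monoʳ-≤ (toℕ i) i≤j) ⟩
      2 + (toℕ i + toℕ j)   ≤⟨ below ⟩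
      m + m + b             ≤⟨ +-monoʳ-≤ (m + m) b≤1 ⟩
      m + m + 1             ≡⟨ +-comm (m + m) 1 ⟩
      suc (m + m)           ∎)
    i<m : toℕ i < m
    i<m = ≰⇒> (λ m≤i → <⇒≱ i+i<m+m (+-mono-≤ m≤i m≤i))
    p = fromℕ< i<m
    r = fromℕ< j<m+b
    p,r↦x : cell p r ≡ (i , j)
    p,r↦x with cell p r | cellShape p r
    ... | _ | upper _ = cong₂ _,_ (toℕ-injective (trans (toℕ-inject≤ p m≤N) (toℕ-fromℕ< i<m)))
                                  (toℕ-injective (trans (toℕ-inject≤ r m+b≤N) (toℕ-fromℕ< j<m+b)))
    ... | _ | lower r<p = ⊥-elim (<⇒≱ (subst₂ _<_ (toℕ-fromℕ< j<m+b) (toℕ-fromℕ< i<m) r<p) i≤j)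
  ... | no  j≮m+b = p , r , p,r↦x
    where
    open ≤-Reasoning
    o = toℕ (opposite j)
    i<o : toℕ i < o
    i<o = +-cancelʳ-≤ (suc (toℕ j)) (suc (toℕ i)) o (begin
      suc (toℕ i) + suc (toℕ j)   ≡⟨ cong suc (+-suc (toℕ i) (toℕ j)) ⟩
      2 + (toℕ i + toℕ j)         ≤⟨ below ⟩
      N                           ≡⟨ sym (toℕ-opposite+suc j) ⟩
      o + suc (toℕ j)             ∎)
    o<m : o < m
    o<m = +-cancelʳ-≤ (m + b) (suc o) m (begin
      suc o + (m + b)             ≡⟨ sym (+-suc o (m + b)) ⟩
      o + suc (m + b)             ≤⟨ +-monoʳ-≤ o (s≤s (≮⇒≥ j≮m+b)) ⟩
      o + suc (toℕ j)             ≡⟨ toℕ-opposite+suc j ⟩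
      N                           ≡⟨ +-assoc m m b ⟩
      m + (m + b)                 ∎)
    p = fromℕ< o<m
    r = fromℕ< (≤-trans (<-trans i<o o<m) (m≤m+n m b))
    p,r↦x : cell p r ≡ (i , j)
    p,r↦x with cell p r | cellShape p r
    ... | _ | upper p≤r = ⊥-elim (<⇒≱ i<o (subst₂ _≤_ (toℕ-fromℕ< o<m) (toℕ-fromℕ< _) p≤r))
    ... | _ | lower _ =
      cong₂ _,_ (toℕ-injective (trans (toℕ-inject≤ r m+b≤N) (toℕ-fromℕ< _)))
                (trans (cong opposite (toℕ-injective (trans (toℕ-inject≤ p m≤N) (toℕ-fromℕ< o<m))))
                       (opposite-involutive j))

module Dimension (m b : ℕ.ℕ) (b≤1 : b ℕ.≤ 1) where
  open import Data.Fin using (Fin; zero; suc; remQuot; combine)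
  open import Data.Fin.Properties using (remQuot-combine; combine-remQuot)
  open import Data.Integer using (+≤+; +<+)
  open import Data.Nat using (ℕ; suc; z≤n; s≤s)
  open import Data.Product using (Σ; _,_; uncurry)
  open import Data.Rational using (ℚ; 0ℚ; _*_; _≤_; 1/_; Positive; NonNegative; NonZero; *<*; *≤*)
  open import Data.Rational.Base using (positive)
  open import Data.Rational.Properties
    using (+-*-ring; *-distribˡ-+; *-zeroʳ; *-comm; *-inverseʳ; <⇒≢; positive⁻¹; pos⇒nonZero; pos⇒nonNeg;
           1/pos⇒pos; *-monoˡ-≤-nonNeg)
  open import Defs
  open import Function using (_∘_)
  open import Relation.Binary.PropositionalEquality
  open import Algebra.Bundles using (Ring)
  open import Algebra.Properties.Semiring.Mult (Ring.semiring +-*-ring) using (×-assoc-*) renaming (_×_ to _times_)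
  open AffineDimension
  open Cells
  open BalancedMatrices
  open Witnesses
  open DoublyStochastic
  open Representatives m b b≤1

  d : ℕ
  d = m ℕ.* (m ℕ.+ b)

  representativeCell : Fin d → Cell N
  representativeCell u = uncurry cell (remQuot (m ℕ.+ b) u)

  representativeCell-representative : ∀ u → IsRepresentative (representativeCell u)
  representativeCell-representative u = uncurry cell-representative (remQuot (m ℕ.+ b) u)

  representativeCell-injective : ∀ {u v} → representativeCell u ≡ representativeCell v → u ≡ v
  representativeCell-injective {u} {v} eq = begin
    u                                          ≡⟨ sym (combine-remQuot {m} (m ℕ.+ b) u) ⟩
    uncurry combine (remQuot {m} (m ℕ.+ b) u)  ≡⟨ cong (uncurry combine) (cell-injective eq) ⟩
    uncurry combine (remQuot {m} (m ℕ.+ b) v)  ≡⟨ combine-remQuot {m} (m ℕ.+ b) v ⟩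
    v                                          ∎
    where open ≡-Reasoning

  representativeCell-surjective : ∀ {x} → IsRepresentative x → Σ (Fin d) λ u → representativeCell u ≡ x
  representativeCell-surjective rep with cell-surjective rep
  ... | p , r , eq = combine p r , trans (cong (uncurry cell) (remQuot-combine p r)) eq

  representativesDetermineDifferences : CellsDetermineDifferences InΩth representativeCell
  representativesDetermineDifferences c P P∈Ω sum-c≡0 vanish =
    balanced-vanishing (balanced-combination c P P∈Ω sum-c≡0) vanishOnRepresentatives
    where
    vanishOnRepresentatives : ∀ x → IsRepresentative x → combination c P at x ≡ 0ℚ
    vanishOnRepresentatives x rep with representativeCell-surjective rep
    ... | u , refl = vanish u

  module _ (1≤N : 1 ℕ.≤ N) where
    instance
      N×8-positive : Positive (N times eight)
      N×8-positive = positive (0<times 1≤N (*<* (+<+ (s≤s z≤n))))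
      N×8-nonZero : NonZero (N times eight)
      N×8-nonZero = pos⇒nonZero (N times eight)

    ε : ℚ
    ε = 1/ (N times eight)

    instance
      ε-positive : Positive ε
      ε-positive = 1/pos⇒pos (N times eight)
      ε-nonNegative : NonNegative ε
      ε-nonNegative = pos⇒nonNeg ε

    0≤ε* : ∀ {q} → 0ℚ ≤ q → 0ℚ ≤ ε * q
    0≤ε* 0≤q = subst (_≤ ε * _) (*-zeroʳ ε) (*-monoˡ-≤-nonNeg ε 0≤q)

    base : Mat N
    base _ _ = ε * eight

    translate : Fin d → Mat N
    translate u i j = ε * witness (representativeCell u) i j

    points : Fin (suc d) → Mat N
    points = baseAndTranslates base translate

    base∈Ω : InΩth base
    base∈Ω = InΩth-constant (0≤ε* (*≤* (+≤+ z≤n)))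
      (trans (cong (N times_) (*-comm ε eight)) (trans (sym (×-assoc-* N eight ε)) (*-inverseʳ (N times eight))))

    points∈Ω : ∀ l → InΩth (points l)
    points∈Ω zero    = base∈Ω
    points∈Ω (suc u) = InΩth-translate base∈Ω (balanced-scale ε (witness-balanced (representativeCell u)))
      (λ i j → subst (0ℚ ≤_) (*-distribˡ-+ ε eight _) (0≤ε* (witness-lowerBound (representativeCell u) i j)))

    points-independent : AffinelyIndependent points
    points-independent =
      affinelyIndependent-baseAndTranslates representativeCell base translate translate-off translate-self
      where
      rep = representativeCell-representative
      translate-off : ∀ u v → u ≢ v → translate u at representativeCell v ≡ 0ℚ
      translate-off u v u≢v =
        trans (cong (ε *_) (witness-off (rep u) (rep v) (u≢v ∘ sym ∘ representativeCell-injective))) (*-zeroʳ ε)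
      translate-self : ∀ u → translate u at representativeCell u ≢ 0ℚ
      translate-self u ε*W≡0 = <⇒≢ (positive⁻¹ ε) (sym (p*q≡0⇒p≡0 ε _ (≢0 ∘ sym) ε*W≡0))
        where ≢0 = <⇒≢ (0<witness-self (rep u))

    dimension : HasAffineDim (InΩth {N}) d
    dimension = (points , points∈Ω , points-independent)
              , ¬affinelyIndependent InΩth representativeCell representativesDetermineDifferences

open import Defs
open import Data.Nat using (ℕ; _*_; _∸_; _≤_; _/_; _%_)
open import Data.Product using (_×_)
open import Relation.Binary.PropositionalEquality using (_≡_)

open import Data.Nat using (zero; suc; _+_; z≤n; s≤s; ≤-pred)
open import Data.Product using (_,_)
open import Data.Nat.DivMod using (m≡m%n+[m/n]*n; m*n/n≡m; m%n<n)
open import Data.Nat.Properties using (m+n∸m≡n)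
open import Data.Nat.Solver using (module +-*-Solver)
open import Relation.Binary.PropositionalEquality using (refl; sym; trans; cong; subst; module ≡-Reasoning)
open +-*-Solver using (solve; _:+_; _:*_; _:=_; con)

quarterSquare : ∀ m b → b ≤ 1 → ((m + m + b) * (m + m + b) ∸ b) / 4 ≡ m * (m + b)
quarterSquare m zero z≤n = begin
  (m + m + 0) * (m + m + 0) / 4
    ≡⟨ cong (_/ 4) (solve 1 (λ m → (m :+ m :+ con 0) :* (m :+ m :+ con 0) := m :* (m :+ con 0) :* con 4) refl m) ⟩
  m * (m + 0) * 4 / 4   ≡⟨ m*n/n≡m (m * (m + 0)) 4 ⟩
  m * (m + 0)           ∎
  where open ≡-Reasoning
quarterSquare m (suc zero) (s≤s z≤n) = begin
  ((m + m + 1) * (m + m + 1) ∸ 1) / 4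
    ≡⟨ cong (λ k → (k ∸ 1) / 4)
            (solve 1 (λ m → (m :+ m :+ con 1) :* (m :+ m :+ con 1) := con 1 :+ m :* (m :+ con 1) :* con 4) refl m) ⟩
  (1 + m * (m + 1) * 4 ∸ 1) / 4         ≡⟨ cong (_/ 4) (m+n∸m≡n 1 (m * (m + 1) * 4)) ⟩
  m * (m + 1) * 4 / 4                   ≡⟨ m*n/n≡m (m * (m + 1)) 4 ⟩
  m * (m + 1)                           ∎
  where open ≡-Reasoning

theorem3p2 : (n : ℕ) → 1 ≤ n →
    ((n % 2 ≡ 0 → HasAffineDim (InΩth {n}) ((n * n) / 4)) ×
     (n % 2 ≡ 1 → HasAffineDim (InΩth {n}) ((n * n ∸ 1) / 4)))
theorem3p2 n 1≤n = (λ even → subst Ω-hasDim even Ω-dimension)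
                 , (λ odd  → subst Ω-hasDim odd Ω-dimension)
  where
  m = n / 2
  b = n % 2
  Ω-hasDim : ℕ → Set
  Ω-hasDim b′ = HasAffineDim (InΩth {n}) ((n * n ∸ b′) / 4)
  b≤1 : b ≤ 1
  b≤1 = ≤-pred (m%n<n n 2)
  halves : m + m + b ≡ n
  halves = sym (trans (m≡m%n+[m/n]*n n 2) (solve 2 (λ b m → b :+ m :* con 2 := m :+ m :+ b) refl b m))
  Ω-dimension : Ω-hasDim b
  Ω-dimension = subst (λ N → HasAffineDim (InΩth {N}) ((N * N ∸ b) / 4)) halves
    (subst (HasAffineDim (InΩth {m + m + b})) (sym (quarterSquare m b b≤1))
      (Dimension.dimension m b b≤1 (subst (1 ≤_) (sym halves) 1≤n)))
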